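{- Let $n\geqslant 2$ be an integer. Let $S\supset \mathbb{Z}/n\mathbb{Z}$ be a faithful, finite, associative, commutative $\mathbb{Z}/n\mathbb{Z}$-algebra with unit. Let $\sigma$ be a $\mathbb{Z}/n\mathbb{Z}$-algebra endomorphism of $S$. Let $\Omega\subset S$ be a subset such that the smallest $\mathbb{Z}/n\mathbb{Z}$-subalgebra of $S$ containing $\Omega$ and stable under $\sigma$ is $S$ itself. Assume $\omega^n=\sigma(\omega)$ for every $\omega\in\Omega$. If $n$ is prime, then $x^n=\sigma(x)$ for every $x\in S$. -}

module Defs where

open import Level using (Level; _⊔_)
open import Algebra.Bundles using (CommutativeRing; Semiring)
open import Data.Nat using (ℕ; zero; suc; _<_)
open import Data.Fin using (Fin)
open import Data.Product using (Σ; ∃; _×_)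
open import Relation.Binary.PropositionalEquality using (_≡_)

module _ {c ℓ : Level} (S : CommutativeRing c ℓ) where
  open CommutativeRing S
  open import Algebra.Definitions.RawSemiring (Semiring.rawSemiring semiring)
    using () renaming (_×_ to _·_; _^_ to _^ʳ_)

  pow : Carrier → ℕ → Carrier
  pow x m = x ^ʳ m

  -- S is a Z/nZ-algebra: n · 1 = 0 (the Z/nZ-algebra structure of a ring
  -- is unique when it exists, given by m mod n ↦ m · 1).
  IsZModAlgebra : ℕ → Set ℓ
  IsZModAlgebra n = n · 1# ≈ 0#

  -- Faithful (S ⊃ Z/nZ): the structure map Z/nZ → S is injective,
  -- i.e. for 0 ≤ m < n, m · 1 = 0 implies m = 0.
  IsFaithful : ℕ → Set ℓ
  IsFaithful n = ∀ m → m < n → m · 1# ≈ 0# → m ≡ 0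

  IsFinite : Set (c ⊔ ℓ)
  IsFinite = Σ ℕ λ k → Σ (Fin k → Carrier) λ f → ∀ x → ∃ λ i → f i ≈ x

  -- Membership in the smallest Z/nZ-subalgebra of S containing Ω and
  -- stable under σ (inductively generated; closed under the setoid
  -- equality, contains 0, 1 and Ω, closed under +, -, *, σ; closure under
  -- scalar multiplication by Z/nZ follows from 1 and +).
  data Generated {p : Level} (Ω : Carrier → Set p) (σ : Carrier → Carrier)
       : Carrier → Set (c ⊔ ℓ ⊔ p) where
    gen-Ω   : ∀ {x} → Ω x → Generated Ω σ x
    gen-≈   : ∀ {x y} → x ≈ y → Generated Ω σ x → Generated Ω σ y
    gen-0   : Generated Ω σ 0#
    gen-1   : Generated Ω σ 1#
    gen-+   : ∀ {x y} → Generated Ω σ x → Generated Ω σ y → Generated Ω σ (x + y)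
    gen-neg : ∀ {x} → Generated Ω σ x → Generated Ω σ (- x)
    gen-*   : ∀ {x y} → Generated Ω σ x → Generated Ω σ y → Generated Ω σ (x * y)
    gen-σ   : ∀ {x} → Generated Ω σ x → Generated Ω σ (σ x)

{-# OPTIONS --safe #-}
module Submission where

-- In characteristic p the binomial coefficients p C k with 0 < k < p vanish,
-- so x ↦ x ^ p is a ring endomorphism (the Frobenius). It therefore agrees
-- with σ on a subring containing Ω, and that subring is σ-stable because
-- (σ x) ^ p ≈ σ (x ^ p).

open import Defs
open import Level using (Level)
open import Algebra.Bundles using (CommutativeRing; CommutativeSemiring)
open import Algebra.Morphism.Structures using (module RingMorphisms)
open import Data.Nat as ℕ using (ℕ; zero; suc; _≤_; _<_; z≤n; s≤s; _!; nonTrivial⇒≢1)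
open import Data.Nat.Properties using (_!*_!≢0; <⇒≤; <⇒≱; n<1+n; <-trans; ∸-monoʳ-<; n∸n≡0)
open import Data.Nat.Primality using (Prime; euclidsLemma; prime⇒nonTrivial; prime⇒nonZero)
open import Data.Nat.Divisibility using (_∣_; _∤_; divides; ∣⇒≤; ∣1⇒≡1; m∣m*n)
open import Data.Nat.DivMod using (m/n*n≡m)
open import Data.Nat.Combinatorics using (_C_; nCn≡1; nCk≡n!/k![n-k]!; k![n∸k]!∣n!)
open import Data.Fin as Fin using (Fin; toℕ; fromℕ; inject₁)
open import Data.Fin.Properties using (toℕ-fromℕ; inject₁ℕ<)
open import Data.Vec.Functional using (init; tail)
open import Data.Sum using (inj₁; inj₂)
open import Data.Empty using (⊥-elim)
open import Relation.Binary.PropositionalEquality as ≡ using (_≡_; refl; cong; subst; module ≡-Reasoning)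

module _ where
  open import Data.Nat using (_*_; _/_; _∸_)

  prime∤! : ∀ {p j} → Prime p → j < p → p ∤ j !
  prime∤! {j = zero}  pp _ p∣1 = nonTrivial⇒≢1 {{prime⇒nonTrivial pp}} (∣1⇒≡1 p∣1)
  prime∤! {j = suc i} pp j<p p∣j! with euclidsLemma (suc i) (i !) pp p∣j!
  ... | inj₁ p∣j  = <⇒≱ j<p (∣⇒≤ p∣j)
  ... | inj₂ p∣i! = prime∤! pp (<-trans (n<1+n i) j<p) p∣i!

  nCk*k![n∸k]!≡n! : ∀ {n k} → k ≤ n → (n C k) * (k ! * (n ∸ k) !) ≡ n !
  nCk*k![n∸k]!≡n! {n} {k} k≤n = begin
    (n C k) * (k ! * (n ∸ k) !)                 ≡⟨ cong (_* (k ! * (n ∸ k) !)) (nCk≡n!/k![n-k]! k≤n) ⟩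
    n ! / (k ! * (n ∸ k) !) * (k ! * (n ∸ k) !) ≡⟨ m/n*n≡m (k![n∸k]!∣n! k≤n) ⟩
    n !                                         ∎
    where
    open ≡-Reasoning
    instance _ = k !* (n ∸ k) !≢0

  prime∣binomial : ∀ {p k} → Prime p → 0 < k → k < p → p ∣ p C k
  prime∣binomial {suc q} {k} pp 0<k k<p
    with euclidsLemma (suc q C k) (k ! * (suc q ∸ k) !) pp
           (subst (suc q ∣_) (≡.sym (nCk*k![n∸k]!≡n! (<⇒≤ k<p))) (m∣m*n (q !)))
  ... | inj₁ p∣C = p∣C
  ... | inj₂ p∣k![p∸k]! with euclidsLemma (k !) ((suc q ∸ k) !) pp p∣k![p∸k]!
  ...   | inj₁ p∣k!     = ⊥-elim (prime∤! pp k<p p∣k!)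
  ...   | inj₂ p∣[p∸k]! = ⊥-elim (prime∤! pp (∸-monoʳ-< 0<k (<⇒≤ k<p)) p∣[p∸k]!)

module _ {c ℓ : Level} (R : CommutativeSemiring c ℓ) where
  open CommutativeSemiring R
  open import Algebra.Properties.Semiring.Exp semiring using (_^_)
  open import Algebra.Properties.Semiring.Mult semiring using (_×_; ×-congʳ; ×-assoc-*; ×1-homo-*)
  open import Algebra.Properties.Semiring.Sum semiring using (sum; sum-cong-≋; sum-init-last; sum-replicate-zero)
  open import Algebra.Properties.CommutativeSemiring.Binomial R
    using (binomialTerm) renaming (theorem to binomial-theorem)
  open import Relation.Binary.Reasoning.Setoid setoid

  char∣⇒×≈0# : ∀ {p j} → p × 1# ≈ 0# → p ∣ j → ∀ a → j × a ≈ 0#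
  char∣⇒×≈0# {p} char (divides t refl) a = begin
    (t ℕ.* p) × a             ≈⟨ ×-congʳ (t ℕ.* p) (*-identityˡ a) ⟨
    (t ℕ.* p) × (1# * a)      ≈⟨ ×-assoc-* (t ℕ.* p) 1# a ⟨
    ((t ℕ.* p) × 1#) * a      ≈⟨ *-congʳ (×1-homo-* t p) ⟩
    ((t × 1#) * (p × 1#)) * a ≈⟨ *-congʳ (*-congˡ char) ⟩
    ((t × 1#) * 0#) * a       ≈⟨ *-congʳ (zeroʳ (t × 1#)) ⟩
    0# * a                    ≈⟨ zeroˡ a ⟩
    0#                        ∎

  binomialTerm-first : ∀ x y n → binomialTerm x y n Fin.zero ≈ y ^ n
  binomialTerm-first x y n = trans (+-identityʳ _) (*-identityˡ (y ^ n))

  binomialTerm-last : ∀ x y n → binomialTerm x y n (fromℕ n) ≈ x ^ n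
  binomialTerm-last x y n rewrite toℕ-fromℕ n | nCn≡1 n | n∸n≡0 n =
    trans (+-identityʳ _) (*-identityʳ (x ^ n))

  binomialTerm-vanishes : ∀ {p} → Prime p → p × 1# ≈ 0# →
                          ∀ x y (k : Fin (suc p)) → 0 < toℕ k → toℕ k < p →
                          binomialTerm x y p k ≈ 0#
  binomialTerm-vanishes pp char x y k 0<k k<p =
    char∣⇒×≈0# char (prime∣binomial pp 0<k k<p) _

  frobenius-+ : ∀ {p} → Prime p → p × 1# ≈ 0# → ∀ x y → (x + y) ^ p ≈ x ^ p + y ^ p
  frobenius-+ {suc q} pp char x y = begin
    (x + y) ^ p                                               ≈⟨ binomial-theorem p x y ⟩
    term Fin.zero + sum (tail term)                           ≈⟨ +-congˡ (sum-init-last (tail term)) ⟩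
    term Fin.zero + (sum (init (tail term)) + term (fromℕ p)) ≈⟨ +-cong (binomialTerm-first x y p)
                                                                   (+-cong inner-terms-vanish (binomialTerm-last x y p)) ⟩
    y ^ p + (0# + x ^ p)                                      ≈⟨ +-congˡ (+-identityˡ (x ^ p)) ⟩
    y ^ p + x ^ p                                             ≈⟨ +-comm (y ^ p) (x ^ p) ⟩
    x ^ p + y ^ p                                             ∎
    where
    p = suc q
    term = binomialTerm x y p
    inner-terms-vanish : sum (init (tail term)) ≈ 0#
    inner-terms-vanish = trans
      (sum-cong-≋ λ i → binomialTerm-vanishes pp char x y (Fin.suc (inject₁ i)) (s≤s z≤n) (s≤s (inject₁ℕ< i)))
      (sum-replicate-zero q)

module _ {c ℓ : Level} (R : CommutativeRing c ℓ) where
  open CommutativeRing R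
  open import Algebra.Properties.Semiring.Exp semiring using (_^_; ^-congˡ)
  open import Algebra.Properties.CommutativeSemiring.Exp commutativeSemiring using (^-distrib-*)
  open import Algebra.Properties.Semiring.Mult semiring using (_×_)
  open import Algebra.Properties.Group +-group using (inverseʳ-unique)
  import Algebra.Properties.Monoid.Mult *-monoid as Power
  open RingMorphisms using (IsRingHomomorphism)
  open import Relation.Binary.Reasoning.Setoid setoid

  frobenius-‿ : ∀ {p} → Prime p → p × 1# ≈ 0# → ∀ x → (- x) ^ p ≈ - (x ^ p)
  frobenius-‿ {p} pp char x = inverseʳ-unique (x ^ p) ((- x) ^ p) (begin
    x ^ p + (- x) ^ p ≈⟨ frobenius-+ commutativeSemiring pp char x (- x) ⟨
    (x + - x) ^ p     ≈⟨ ^-congˡ p (-‿inverseʳ x) ⟩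
    0# ^ p            ≈⟨ Power.×-idem (zeroˡ 0#) p ⟩
    0#                ∎)
    where instance _ = prime⇒nonZero pp

  module _ {σ : Carrier → Carrier} (σ-hom : IsRingHomomorphism rawRing rawRing σ) where
    open IsRingHomomorphism σ-hom

    ^-homo : ∀ x n → σ (x ^ n) ≈ σ x ^ n
    ^-homo x zero    = 1#-homo
    ^-homo x (suc n) = trans (*-homo x (x ^ n)) (*-congˡ (^-homo x n))

    generated⇒frobenius≈σ : ∀ {p ℓ′} {Ω : Carrier → Set ℓ′} → Prime p → p × 1# ≈ 0# →
                            (∀ ω → Ω ω → ω ^ p ≈ σ ω) →
                            ∀ {x} → Generated R Ω σ x → x ^ p ≈ σ x
    generated⇒frobenius≈σ {p} pp char onΩ = agree
      where
      instance _ = prime⇒nonZero pp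
      agree : ∀ {x} → Generated R _ σ x → x ^ p ≈ σ x
      agree (gen-Ω ω∈Ω) = onΩ _ ω∈Ω
      agree (gen-≈ x≈y g) = trans (^-congˡ p (sym x≈y)) (trans (agree g) (⟦⟧-cong x≈y))
      agree gen-0 = trans (Power.×-idem (zeroˡ 0#) p) (sym 0#-homo)
      agree gen-1 = trans (Power.×-idem (*-identityˡ 1#) p) (sym 1#-homo)
      agree (gen-+ {x} {y} g h) = begin
        (x + y) ^ p     ≈⟨ frobenius-+ commutativeSemiring pp char x y ⟩
        x ^ p + y ^ p   ≈⟨ +-cong (agree g) (agree h) ⟩
        σ x + σ y       ≈⟨ +-homo x y ⟨
        σ (x + y)       ∎
      agree (gen-neg {x} g) = begin
        (- x) ^ p       ≈⟨ frobenius-‿ pp char x ⟩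
        - (x ^ p)       ≈⟨ -‿cong (agree g) ⟩
        - σ x           ≈⟨ -‿homo x ⟨
        σ (- x)         ∎
      agree (gen-* {x} {y} g h) = begin
        (x * y) ^ p     ≈⟨ ^-distrib-* x y p ⟩
        x ^ p * y ^ p   ≈⟨ *-cong (agree g) (agree h) ⟩
        σ x * σ y       ≈⟨ *-homo x y ⟨
        σ (x * y)       ∎
      agree (gen-σ {x} g) = begin
        σ x ^ p         ≈⟨ ^-homo x p ⟨
        σ (x ^ p)       ≈⟨ ⟦⟧-cong (agree g) ⟩
        σ (σ x)         ∎

theorem2 : ∀ {c ℓ p : Level} (n : ℕ) → 2 ≤ n →
    (S : CommutativeRing c ℓ) →
    IsZModAlgebra S n → IsFaithful S n → IsFinite S →
    (σ : CommutativeRing.Carrier S → CommutativeRing.Carrier S) →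
    RingMorphisms.IsRingHomomorphism (CommutativeRing.rawRing S) (CommutativeRing.rawRing S) σ →
    (Ω : CommutativeRing.Carrier S → Set p) →
    (∀ x → Generated S Ω σ x) →
    (∀ ω → Ω ω → CommutativeRing._≈_ S (pow S ω n) (σ ω)) →
    Prime n →
    ∀ x → CommutativeRing._≈_ S (pow S x n) (σ x)
theorem2 _ _ S char _ _ σ σ-hom _ generates onΩ prime x =
  generated⇒frobenius≈σ S σ-hom prime char onΩ (generates x)
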